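{- Let $N\ge 1$, and let $a_1,\dots,a_N,c_1,\dots,c_N$ be real numbers with $\sum_{j=1}^N a_j=\sum_{j=1}^N c_j$. Let $n\ge 1$ and let $k_1,\dots,k_n$ be arbitrary real numbers. Define finite sequences $x^{(m)}$ and $y^{(m)}$ of length $2^{m-1}N$ for $1\le m\le n$ recursively by $x^{(1)}=(a_1+k_1,\dots,a_N+k_1)$, $y^{(1)}=(c_1+k_1,\dots,c_N+k_1)$, and for $2\le m\le n$ and $1\le j\le 2^{m-2}N$: $x^{(m)}_j=x^{(m-1)}_j$, $x^{(m)}_{2^{m-2}N+j}=y^{(m-1)}_j+k_m$, $y^{(m)}_j=y^{(m-1)}_j$, $y^{(m)}_{2^{m-2}N+j}=x^{(m-1)}_j+k_m$. Write $x_i=x^{(n)}_i$, $y_i=y^{(n)}_i$ for $1\le i\le 2^{n-1}N$. Then for every $p$ with $1\le p\le n$: (i) $\displaystyle\sum_{i=1}^{2^{n-1}N}x_i^p=\sum_{i=1}^{2^{n-1}N}y_i^p$, and (ii) $\displaystyle\sum_{i=1}^{2^{p-1}N}x_i^p=\sum_{i=1}^{2^{p-1}N}y_i^p$.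
   Context: All numbers are real. By construction the first $2^{m-1}N$ entries of $x^{(n)}$ (resp. $y^{(n)}$) coincide with $x^{(m)}$ (resp. $y^{(m)}$) for $m\le n$. -}

module Defs where

open import Algebra.Bundles using (CommutativeRing)
open import Data.Nat using (ℕ; zero; suc)
open import Data.List using (List; []; map; foldr; _++_)
open import Data.Product using (_×_; _,_; proj₁; proj₂)

-- All constructions are over an arbitrary commutative ring R
-- (the paper works over ℝ, which is one instance; the stdlib has no reals).
module _ {c ℓ} (R : CommutativeRing c ℓ) where
  open CommutativeRing R

  pow : Carrier → ℕ → Carrier
  pow x zero    = 1#
  pow x (suc p) = x * pow x p

  sumL : List Carrier → Carrier
  sumL = foldr _+_ 0#

  powSum : ℕ → List Carrier → Carrier
  powSum p zs = sumL (map (λ z → pow z p) zs)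

  -- xy a b k m = (x^(m) , y^(m)) for m ≥ 1, where k m is the paper's k_m.
  -- (The value at m = 0 is a dummy and never used.)
  xy : List Carrier → List Carrier → (ℕ → Carrier) → ℕ → List Carrier × List Carrier
  xy a b k zero = ([] , [])
  xy a b k (suc zero) = (map (λ t → t + k 1) a , map (λ t → t + k 1) b)
  xy a b k (suc (suc m)) =
    let prev = xy a b k (suc m)
        km   = k (suc (suc m))
    in (proj₁ prev ++ map (λ t → t + km) (proj₂ prev)
       , proj₂ prev ++ map (λ t → t + km) (proj₁ prev))

-- Say that two lists agree up to degree q when their power sums of every degree p ≤ q
-- coincide. As (x + k)^p is x^p plus a polynomial of degree < p in x (over any commutative
-- ring, no binomial coefficients needed), lists X, Y agreeing up to degree q satisfy both
--   Σ (x + k)^p = Σ (y + k)^p                       for p ≤ q, and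
--   Σ (x + k)^p − Σ x^p = Σ (y + k)^p − Σ y^p       for p = q + 1.
-- The second identity makes X ++ (Y + k) and Y ++ (X + k) agree up to degree q + 1; since a, b
-- agree up to degree 1, x^(m) and y^(m) agree up to degree m, which is (i). For (ii), x^(p)
-- and y^(p) are the prefixes of length 2^(p-1) N of x^(n) and y^(n).
module Submission where

open import Defs
open import Algebra.Bundles using (CommutativeRing)
open import Data.Nat using (ℕ; _≤_; _*_; _^_; _∸_)
open import Data.List using (take)
open import Data.Vec using (Vec; toList)
open import Data.Product using (_×_; proj₁; proj₂)

open import Data.Nat using (zero; suc; s≤s; s≤s⁻¹; _≤′_; ≤′-reflexive; ≤′-step)
import Data.Nat as ℕ
import Data.Nat.Properties as ℕₚ
open import Data.List using (List; []; _∷_; map; _++_; length)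
open import Data.List.Properties using (length-map; length-++; map-++; map-∘)
open import Data.List.Relation.Binary.Prefix.Heterogeneous using (Prefix; []; _∷_; _++ᵖ_)
open import Data.List.Relation.Binary.Prefix.Heterogeneous.Properties using (fromPointwise)
import Data.List.Relation.Binary.Pointwise as Pointwise
open import Data.Vec.Properties using (length-toList)
open import Data.Product using (_,_)
open import Relation.Binary.PropositionalEquality as ≡ using (_≡_)

Prefix-refl : ∀ {a} {A : Set a} (xs : List A) → Prefix _≡_ xs xs
Prefix-refl xs = fromPointwise (Pointwise.refl ≡.refl)

take-length-Prefix : ∀ {a} {A : Set a} {xs ys : List A} → Prefix _≡_ xs ys → take (length xs) ys ≡ xs
take-length-Prefix []             = ≡.refl
take-length-Prefix (≡.refl ∷ pre) = ≡.cong (_ ∷_) (take-length-Prefix pre)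

length-++-map : ∀ {a} {A : Set a} {L} (f : A → A) (xs ys : List A) →
                length xs ≡ L → length ys ≡ L → length (xs ++ map f ys) ≡ 2 * L
length-++-map {L = L} f xs ys |xs|≡L |ys|≡L = begin
  length (xs ++ map f ys)         ≡⟨ length-++ xs ⟩
  length xs ℕ.+ length (map f ys) ≡⟨ ≡.cong₂ ℕ._+_ |xs|≡L (≡.trans (length-map f ys) |ys|≡L) ⟩
  L ℕ.+ L                         ≡⟨ ≡.cong (L ℕ.+_) (≡.sym (ℕₚ.+-identityʳ L)) ⟩
  2 * L                           ∎
  where open ≡.≡-Reasoning

module _ {c ℓ} (R : CommutativeRing c ℓ) where
  open CommutativeRing R renaming (_*_ to _·_)
  open import Algebra.Properties.CommutativeSemigroup +-commutativeSemigroup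
    using (xy∙z≈xz∙y) renaming (interchange to +-interchange)
  open import Algebra.Properties.Group +-group using (∙-cancelʳ)
  open import Algebra.Solver.Ring.NaturalCoefficients.Default commutativeSemiring
  open import Relation.Binary.Reasoning.Setoid setoid

  sumMap : (Carrier → Carrier) → List Carrier → Carrier
  sumMap f X = sumL R (map f X)

  sumMap-cong : ∀ {f g : Carrier → Carrier} → (∀ x → f x ≈ g x) → ∀ X → sumMap f X ≈ sumMap g X
  sumMap-cong f≈g []      = refl
  sumMap-cong f≈g (x ∷ X) = +-cong (f≈g x) (sumMap-cong f≈g X)

  sumMap-+ : ∀ (f g : Carrier → Carrier) X → sumMap (λ x → f x + g x) X ≈ sumMap f X + sumMap g X
  sumMap-+ f g []      = sym (+-identityˡ 0#)
  sumMap-+ f g (x ∷ X) = begin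
    (f x + g x) + sumMap (λ x → f x + g x) X ≈⟨ +-cong refl (sumMap-+ f g X) ⟩
    (f x + g x) + (sumMap f X + sumMap g X)  ≈⟨ +-interchange (f x) (g x) _ _ ⟩
    (f x + sumMap f X) + (g x + sumMap g X)  ∎

  sumMap-* : ∀ a (f : Carrier → Carrier) X → sumMap (λ x → a · f x) X ≈ a · sumMap f X
  sumMap-* a f []      = sym (zeroʳ a)
  sumMap-* a f (x ∷ X) = trans (+-cong refl (sumMap-* a f X)) (sym (distribˡ a (f x) _))

  sumL-++ : ∀ X Y → sumL R (X ++ Y) ≈ sumL R X + sumL R Y
  sumL-++ []      Y = sym (+-identityˡ _)
  sumL-++ (x ∷ X) Y = trans (+-cong refl (sumL-++ X Y)) (sym (+-assoc _ _ _))

  powSum-++ : ∀ p X Y → powSum R p (X ++ Y) ≈ powSum R p X + powSum R p Y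
  powSum-++ p X Y = trans (reflexive (≡.cong (sumL R) (map-++ _ X Y))) (sumL-++ (map (λ z → pow R z p) X) _)

  PowerSumsAgree : ℕ → List Carrier → List Carrier → Set ℓ
  PowerSumsAgree q X Y = ∀ p → p ≤ q → powSum R p X ≈ powSum R p Y

  powSum-zero : ∀ X Y → length X ≡ length Y → powSum R 0 X ≈ powSum R 0 Y
  powSum-zero []      []      _   = refl
  powSum-zero (_ ∷ X) (_ ∷ Y) eq = +-cong refl (powSum-zero X Y (ℕₚ.suc-injective eq))

  powSum-one : ∀ X → powSum R 1 X ≈ sumL R X
  powSum-one []      = refl
  powSum-one (x ∷ X) = +-cong (*-identityʳ x) (powSum-one X)

  PowerSumsAgree-one : ∀ X Y → length X ≡ length Y → sumL R X ≈ sumL R Y → PowerSumsAgree 1 X Y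
  PowerSumsAgree-one X Y |X|≡|Y| _     zero          _        = powSum-zero X Y |X|≡|Y|
  PowerSumsAgree-one X Y _       ΣX≈ΣY (suc zero)    _        =
    trans (powSum-one X) (trans ΣX≈ΣY (sym (powSum-one Y)))
  PowerSumsAgree-one X Y _       _     (suc (suc _)) (s≤s ())

  shift : Carrier → List Carrier → List Carrier
  shift k = map (_+ k)

  mixedPowSum : Carrier → ℕ → ℕ → List Carrier → Carrier
  mixedPowSum k i j = sumMap (λ x → pow R x i · pow R (x + k) j)

  mixedPowSum-zero : ∀ k i X → mixedPowSum k i 0 X ≈ powSum R i X
  mixedPowSum-zero k i = sumMap-cong (λ x → *-identityʳ (pow R x i))

  mixedPowSum-suc : ∀ k i j X → mixedPowSum k i (suc j) X ≈ mixedPowSum k (suc i) j X + k · mixedPowSum k i j X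
  mixedPowSum-suc k i j X = begin
    mixedPowSum k i (suc j) X
      ≈⟨ sumMap-cong expand X ⟩
    sumMap (λ x → pow R x (suc i) · pow R (x + k) j + k · (pow R x i · pow R (x + k) j)) X
      ≈⟨ sumMap-+ _ _ X ⟩
    mixedPowSum k (suc i) j X + sumMap (λ x → k · (pow R x i · pow R (x + k) j)) X
      ≈⟨ +-cong refl (sumMap-* k _ X) ⟩
    mixedPowSum k (suc i) j X + k · mixedPowSum k i j X
      ∎
    where
    expand : ∀ x → pow R x i · pow R (x + k) (suc j)
                   ≈ pow R x (suc i) · pow R (x + k) j + k · (pow R x i · pow R (x + k) j)
    expand x = solve 4 (λ x k u v → u :* ((x :+ k) :* v) := (x :* u) :* v :+ k :* (u :* v))
                       refl x k (pow R x i) (pow R (x + k) j)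

  powSum-shift : ∀ k p X → powSum R p (shift k X) ≈ mixedPowSum k 0 p X
  powSum-shift k p X = begin
    powSum R p (shift k X)               ≡⟨ ≡.cong (sumL R) (≡.sym (map-∘ X)) ⟩
    sumMap (λ x → pow R (x + k) p) X     ≈⟨ sumMap-cong (λ x → sym (*-identityˡ _)) X ⟩
    mixedPowSum k 0 p X                  ∎

  module _ {q} (X Y : List Carrier) (agree : PowerSumsAgree q X Y) (k : Carrier) where
    mutual
      -- Induction on j via x^i (x + k)^(j+1) = x^(i+1) (x + k)^j + k x^i (x + k)^j, which trades
      -- a power of x + k for a power of x plus a term of lower total degree.
      mixedPowSum-balance : ∀ i j → i ℕ.+ j ≤ suc q →
        mixedPowSum k i j X + powSum R (i ℕ.+ j) Y ≈ mixedPowSum k i j Y + powSum R (i ℕ.+ j) X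
      mixedPowSum-balance i zero _ rewrite ℕₚ.+-identityʳ i = begin
        mixedPowSum k i 0 X + powSum R i Y ≈⟨ +-cong (mixedPowSum-zero k i X) refl ⟩
        powSum R i X + powSum R i Y        ≈⟨ +-comm _ _ ⟩
        powSum R i Y + powSum R i X        ≈⟨ +-cong (sym (mixedPowSum-zero k i Y)) refl ⟩
        mixedPowSum k i 0 Y + powSum R i X ∎
      mixedPowSum-balance i (suc j) i+j<q+1 rewrite ℕₚ.+-suc i j = begin
        mixedPowSum k i (suc j) X + PY                          ≈⟨ +-cong (mixedPowSum-suc k i j X) refl ⟩
        (mixedPowSum k (suc i) j X + k · mixedPowSum k i j X) + PY ≈⟨ xy∙z≈xz∙y _ _ _ ⟩
        (mixedPowSum k (suc i) j X + PY) + k · mixedPowSum k i j X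
          ≈⟨ +-cong (mixedPowSum-balance (suc i) j i+j<q+1) (*-cong refl (mixedPowSum-agree i j (s≤s⁻¹ i+j<q+1))) ⟩
        (mixedPowSum k (suc i) j Y + PX) + k · mixedPowSum k i j Y ≈⟨ xy∙z≈xz∙y _ _ _ ⟩
        (mixedPowSum k (suc i) j Y + k · mixedPowSum k i j Y) + PX ≈⟨ +-cong (sym (mixedPowSum-suc k i j Y)) refl ⟩
        mixedPowSum k i (suc j) Y + PX                          ∎
        where
        PX = powSum R (suc (i ℕ.+ j)) X
        PY = powSum R (suc (i ℕ.+ j)) Y

      mixedPowSum-agree : ∀ i j → i ℕ.+ j ≤ q → mixedPowSum k i j X ≈ mixedPowSum k i j Y
      mixedPowSum-agree i j i+j≤q = ∙-cancelʳ (powSum R (i ℕ.+ j) X) _ _ (begin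
        mixedPowSum k i j X + powSum R (i ℕ.+ j) X ≈⟨ +-cong refl (agree (i ℕ.+ j) i+j≤q) ⟩
        mixedPowSum k i j X + powSum R (i ℕ.+ j) Y ≈⟨ mixedPowSum-balance i j (ℕₚ.m≤n⇒m≤1+n i+j≤q) ⟩
        mixedPowSum k i j Y + powSum R (i ℕ.+ j) X ∎)

    shift-agree : PowerSumsAgree q (shift k X) (shift k Y)
    shift-agree p p≤q = begin
      powSum R p (shift k X) ≈⟨ powSum-shift k p X ⟩
      mixedPowSum k 0 p X    ≈⟨ mixedPowSum-agree 0 p p≤q ⟩
      mixedPowSum k 0 p Y    ≈⟨ sym (powSum-shift k p Y) ⟩
      powSum R p (shift k Y) ∎

    swapShift-agree : PowerSumsAgree (suc q) (X ++ shift k Y) (Y ++ shift k X)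
    swapShift-agree p p≤q+1 = begin
      powSum R p (X ++ shift k Y)            ≈⟨ powSum-++ p X _ ⟩
      powSum R p X + powSum R p (shift k Y)  ≈⟨ +-cong refl (powSum-shift k p Y) ⟩
      powSum R p X + mixedPowSum k 0 p Y     ≈⟨ +-comm _ _ ⟩
      mixedPowSum k 0 p Y + powSum R p X     ≈⟨ sym (mixedPowSum-balance 0 p p≤q+1) ⟩
      mixedPowSum k 0 p X + powSum R p Y     ≈⟨ +-comm _ _ ⟩
      powSum R p Y + mixedPowSum k 0 p X     ≈⟨ +-cong refl (sym (powSum-shift k p X)) ⟩
      powSum R p Y + powSum R p (shift k X)  ≈⟨ sym (powSum-++ p Y _) ⟩
      powSum R p (Y ++ shift k X)            ∎

  module Construction (a b : List Carrier) (k : ℕ → Carrier) where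
    x⁽_⁾ y⁽_⁾ : ℕ → List Carrier
    x⁽ m ⁾ = proj₁ (xy R a b k m)
    y⁽ m ⁾ = proj₂ (xy R a b k m)

    xy-agree : length a ≡ length b → sumL R a ≈ sumL R b →
               ∀ m → PowerSumsAgree (suc m) x⁽ suc m ⁾ y⁽ suc m ⁾
    xy-agree |a|≡|b| Σa≈Σb zero    = shift-agree a b (PowerSumsAgree-one a b |a|≡|b| Σa≈Σb) (k 1)
    xy-agree |a|≡|b| Σa≈Σb (suc m) =
      swapShift-agree x⁽ suc m ⁾ y⁽ suc m ⁾ (xy-agree |a|≡|b| Σa≈Σb m) (k (suc (suc m)))

    length-xy : ∀ {L} → length a ≡ L → length b ≡ L →
                ∀ m → length x⁽ suc m ⁾ ≡ 2 ^ m * L × length y⁽ suc m ⁾ ≡ 2 ^ m * L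
    length-xy {L} |a|≡L |b|≡L zero =
      ≡.trans (length-map _ a) (≡.trans |a|≡L 1*L≡L) , ≡.trans (length-map _ b) (≡.trans |b|≡L 1*L≡L)
      where
      1*L≡L : L ≡ 1 * L
      1*L≡L = ≡.sym (ℕₚ.*-identityˡ L)
    length-xy {L} |a|≡L |b|≡L (suc m) =
      ≡.trans (length-++-map (_+ k′) x⁽ suc m ⁾ y⁽ suc m ⁾ |x|≡ |y|≡) doubling ,
      ≡.trans (length-++-map (_+ k′) y⁽ suc m ⁾ x⁽ suc m ⁾ |y|≡ |x|≡) doubling
      where
      k′ = k (suc (suc m))
      |x|≡ = proj₁ (length-xy |a|≡L |b|≡L m)
      |y|≡ = proj₂ (length-xy |a|≡L |b|≡L m)
      doubling : 2 * (2 ^ m * L) ≡ 2 ^ suc m * L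
      doubling = ≡.sym (ℕₚ.*-assoc 2 (2 ^ m) L)

    xy-Prefix : ∀ {m n} → m ≤′ n →
                Prefix _≡_ x⁽ suc m ⁾ x⁽ suc n ⁾ × Prefix _≡_ y⁽ suc m ⁾ y⁽ suc n ⁾
    xy-Prefix {m} (≤′-reflexive ≡.refl) = Prefix-refl x⁽ suc m ⁾ , Prefix-refl y⁽ suc m ⁾
    xy-Prefix (≤′-step m≤′n)          = proj₁ (xy-Prefix m≤′n) ++ᵖ _ , proj₂ (xy-Prefix m≤′n) ++ᵖ _

    take-xy : ∀ {L m n} → length a ≡ L → length b ≡ L → m ≤ n →
              take (2 ^ m * L) x⁽ suc n ⁾ ≡ x⁽ suc m ⁾ × take (2 ^ m * L) y⁽ suc n ⁾ ≡ y⁽ suc m ⁾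
    take-xy {m = m} {n} |a|≡L |b|≡L m≤n =
      ≡.trans (≡.cong (λ l → take l x⁽ suc n ⁾) (≡.sym (proj₁ lengths)))
              (take-length-Prefix (proj₁ prefixes)) ,
      ≡.trans (≡.cong (λ l → take l y⁽ suc n ⁾) (≡.sym (proj₂ lengths)))
              (take-length-Prefix (proj₂ prefixes))
      where
      lengths  = length-xy |a|≡L |b|≡L m
      prefixes = xy-Prefix (ℕₚ.≤⇒≤′ m≤n)

    take-xy-agree : ∀ {L p n} → length a ≡ L → length b ≡ L → sumL R a ≈ sumL R b → p ≤ n →
      powSum R (suc p) (take (2 ^ p * L) x⁽ suc n ⁾) ≈ powSum R (suc p) (take (2 ^ p * L) y⁽ suc n ⁾)
    take-xy-agree {L} {p} {n} |a|≡L |b|≡L Σa≈Σb p≤n = begin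
      powSum R (suc p) (take (2 ^ p * L) x⁽ suc n ⁾) ≡⟨ ≡.cong (powSum R (suc p)) (proj₁ prefixes) ⟩
      powSum R (suc p) x⁽ suc p ⁾
        ≈⟨ xy-agree (≡.trans |a|≡L (≡.sym |b|≡L)) Σa≈Σb p (suc p) ℕₚ.≤-refl ⟩
      powSum R (suc p) y⁽ suc p ⁾                    ≡⟨ ≡.cong (powSum R (suc p)) (≡.sym (proj₂ prefixes)) ⟩
      powSum R (suc p) (take (2 ^ p * L) y⁽ suc n ⁾) ∎
      where
      prefixes = take-xy |a|≡L |b|≡L p≤n

theorem3 : ∀ {c ℓ} (R : CommutativeRing c ℓ) → let open CommutativeRing R using (Carrier) renaming (_≈_ to _≈R_) in
    (N : ℕ) → 1 ≤ N → (a b : Vec Carrier N) →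
      sumL R (toList a) ≈R sumL R (toList b) →
      (n : ℕ) → 1 ≤ n → (k : ℕ → Carrier) →
      (p : ℕ) → 1 ≤ p → p ≤ n →
        (powSum R p (proj₁ (xy R (toList a) (toList b) k n))
           ≈R powSum R p (proj₂ (xy R (toList a) (toList b) k n)))
        × (powSum R p (take (2 ^ (p ∸ 1) * N) (proj₁ (xy R (toList a) (toList b) k n)))
           ≈R powSum R p (take (2 ^ (p ∸ 1) * N) (proj₂ (xy R (toList a) (toList b) k n))))
theorem3 R N _ a b Σa≈Σb (suc n) _ k (suc p) _ (s≤s p≤n) =
  xy-agree |a|≡|b| Σa≈Σb n (suc p) (s≤s p≤n) , take-xy-agree |a|≡N |b|≡N Σa≈Σb p≤n
  where
  open Construction R (toList a) (toList b) k
  |a|≡N = length-toList a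
  |b|≡N = length-toList b
  |a|≡|b| = ≡.trans |a|≡N (≡.sym |b|≡N)
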